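{- Let $V$ be a finite non-empty set and $T:\mathscr{P}(V)\to\mathscr{P}(V)$ a map. Suppose $(E_1,E_2)$ is a pair of equivalence relations on $V$ with $T(X)=\mathbf{u}_{E_2}(\mathbf{u}_{E_1}(X))$ for all $X\subseteq V$. Then $(E_1,E_2)$ is the unique such pair if and only if: (i) for all $E_2$-classes $[x]_{E_2}\neq[y]_{E_2}$: $\mathbf{u}_{E_1}([x]_{E_2})\neq\mathbf{u}_{E_1}([y]_{E_2})$; (ii) for all $E_1$-classes $[x]_{E_1}\neq[y]_{E_1}$: $\mathbf{u}_{E_2}([x]_{E_1})\neq\mathbf{u}_{E_2}([y]_{E_1})$; (iii) for every $E_2$-class $[x]_{E_2}$ there is an $E_1$-class $[z]_{E_1}$ with $|[x]_{E_2}\cap[z]_{E_1}|=1$; (iv) for every $E_1$-class $[x]_{E_1}$ there is an $E_2$-class $[z]_{E_2}$ with $|[x]_{E_1}\cap[z]_{E_2}|=1$.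
   Context: For an equivalence relation $E$ on $V$: $\mathbf{u}_E(X)=\{x\in V:[x]_E\cap X\neq\emptyset\}$. -}

module Defs where

open import Data.Nat using (ℕ)
open import Data.Bool using (Bool; true; _∧_)
open import Data.Fin using (Fin)
open import Data.Fin.Subset using (Subset)
open import Data.Vec using (tabulate; lookup)
open import Data.List.Base using (allFin)
open import Data.Bool.ListAction using (any)
open import Relation.Binary.PropositionalEquality using (_≡_)

record EqRel (n : ℕ) : Set where
  field
    rel     : Fin n → Fin n → Bool
    reflE   : ∀ x → rel x x ≡ true
    symE    : ∀ x y → rel x y ≡ true → rel y x ≡ true
    transE  : ∀ x y z → rel x y ≡ true → rel y z ≡ true → rel x z ≡ true
open EqRel public

cls : ∀ {n} → EqRel n → Fin n → Subset n
cls E x = tabulate (rel E x)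

u : ∀ {n} → EqRel n → Subset n → Subset n
u {n} E X = tabulate (λ x → any (λ y → rel E x y ∧ lookup X y) (allFin n))

Represents : ∀ {n} → (Subset n → Subset n) → EqRel n → EqRel n → Set
Represents T E₁ E₂ = ∀ X → T X ≡ u E₂ (u E₁ X)

SameRel : ∀ {n} → EqRel n → EqRel n → Set
SameRel {n} E F = ∀ (x y : Fin n) → rel E x y ≡ rel F x y

module Submission where

-- Since u_{E₂}(u_{E₁}(X)) is the set of points joined to X by an E₂-step followed by an
-- E₁-step, a pair represents T exactly when its composite relation is the one determined
-- by T, and uniqueness of the pair is unique factorisation of that composite.
--
-- Given (i)–(iv) and a second factorisation (F₁, F₂): F₂-related points have the same row
-- of the composite, so by (i) they are E₂-related; symmetrically F₁ ⊆ E₁ by (ii).  If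
-- [x]₂ ∩ [z]₁ = {a}, every y ∈ [x]₂ reaches a by an F-path whose middle point lies in
-- that meet, hence is a, so y F₂ a; thus E₂ ⊆ F₂, and E₁ ⊆ F₁ by (iv).
--
-- Conversely, if (i) fails then the kernel of the row map is a second choice of E₂, and
-- if (iii) fails at x₀ then splitting [x₀]₂ into the least points of the meets
-- [x₀]₂ ∩ [z]₁ and the rest (each meet has a second point) is another one; (ii) and (iv)
-- follow by transposing.

open import Defs
open import Data.Nat.Base as ℕ using (ℕ; suc; z≤n; s≤s)
import Data.Nat.Properties as ℕ
open import Data.Bool.Base using (Bool; true; false)
open import Data.Bool.Properties using (T-≡; T-∧; ⇔→≡) renaming (_≟_ to _≟ᵇ_)
open import Data.Fin.Base using (Fin; zero; suc; _≤_)
open import Data.Fin.Properties using (_≟_; _≤?_; all?; any?; ≤-antisym)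
open import Data.Fin.Subset using (Subset; inside; outside; _∈_; _⊆_; _∩_; ⁅_⁆; _-_; ∣_∣; Nonempty)
open import Data.Fin.Subset.Properties
  using (_∈?_; nonempty?; Empty-unique; ∣⊥∣≡0; ∣⁅x⁆∣≡1; x∈⁅x⁆; x∈⁅y⁆⇒x≡y; x∈p∩q⁺; x∈p∩q⁻;
         ⊆-antisym; ⊆-reflexive; x∈p∧x≢y⇒x∈p-y; x∈p⇒∣p-x∣<∣p∣; p⊆q⇒∣p∣≤∣q∣)
open import Data.List.Base using (allFin)
open import Data.List.Membership.Propositional using (lose)
open import Data.List.Membership.Propositional.Properties using (∈-allFin)
open import Data.List.Relation.Unary.Any using (satisfied)
open import Data.List.Relation.Unary.Any.Properties using (any⁺; any⁻)
open import Data.Vec.Base using (_∷_; here; there; tabulate)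
open import Data.Vec.Properties using (lookup∘tabulate; []=⇒lookup; lookup⇒[]=)
import Data.Vec.Properties as Vec
import Data.Product.Properties as Product
open import Data.Product.Base using (_×_; ∃; _,_; proj₁; proj₂; swap)
open import Function.Base using (_∘_)
open import Function.Bundles using (_⇔_; mk⇔; Equivalence)
open import Function.Properties.Equivalence using () renaming (trans to ⇔-trans)
open import Relation.Nullary using (Dec; yes; no; ¬_; ¬?; does; contradiction)
open import Relation.Nullary.Decidable using (dec-true; dec-false; decidable-stable; _×-dec_; _→-dec_)
open import Relation.Unary using (Decidable)
open import Relation.Binary.Definitions using (DecidableEquality)
open import Relation.Binary.PropositionalEquality
  using (_≡_; _≢_; refl; sym; trans; cong; cong₂; subst; module ≡-Reasoning)

private
  variable
    n : ℕ
    x y z : Fin n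
    X : Subset n

_≟ˢ_ : DecidableEquality (Subset n)
_≟ˢ_ = Vec.≡-dec _≟ᵇ_

x∈p⇒⁅x⁆⊆p : {p : Subset n} → x ∈ p → ⁅ x ⁆ ⊆ p
x∈p⇒⁅x⁆⊆p {x = x} x∈p y∈⁅x⁆ = subst (_∈ _) (sym (x∈⁅y⁆⇒x≡y x y∈⁅x⁆)) x∈p

x∈p⇒1≤∣p∣ : {p : Subset n} → x ∈ p → 1 ℕ.≤ ∣ p ∣
x∈p⇒1≤∣p∣ {x = x} x∈p = subst (ℕ._≤ _) (∣⁅x⁆∣≡1 x) (p⊆q⇒∣p∣≤∣q∣ (x∈p⇒⁅x⁆⊆p x∈p))

∣p∣≡1⇒Nonempty : {p : Subset n} → ∣ p ∣ ≡ 1 → Nonempty p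
∣p∣≡1⇒Nonempty {n} {p} ∣p∣≡1 = decidable-stable (nonempty? p) λ empty →
  ℕ.1+n≢0 (trans (sym ∣p∣≡1) (trans (cong ∣_∣ (Empty-unique empty)) (∣⊥∣≡0 n)))

∣p∣≡1⇒∈-unique : {p : Subset n} → ∣ p ∣ ≡ 1 → x ∈ p → y ∈ p → x ≡ y
∣p∣≡1⇒∈-unique {x = x} {y} {p} ∣p∣≡1 x∈p y∈p = decidable-stable (x ≟ y) λ x≢y →
  ℕ.<-irrefl refl (ℕ.≤-<-trans (x∈p⇒1≤∣p∣ (x∈p∧x≢y⇒x∈p-y y∈p (x≢y ∘ sym)))
                               (subst (∣ p - x ∣ ℕ.<_) ∣p∣≡1 (x∈p⇒∣p-x∣<∣p∣ x∈p)))

∣p∣≢1⇒∃-other : {p : Subset n} → x ∈ p → ∣ p ∣ ≢ 1 → ∃ λ y → y ∈ p × y ≢ x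
∣p∣≢1⇒∃-other {x = x} {p} x∈p ∣p∣≢1 with any? (λ y → (y ∈? p) ×-dec ¬? (y ≟ x))
... | yes other = other
... | no ¬other = contradiction (ℕ.≤-antisym ∣p∣≤1 (x∈p⇒1≤∣p∣ x∈p)) ∣p∣≢1
  where
  p⊆⁅x⁆ : p ⊆ ⁅ x ⁆
  p⊆⁅x⁆ {y} y∈p with y ≟ x
  ... | yes refl = x∈⁅x⁆ x
  ... | no y≢x   = contradiction (y , y∈p , y≢x) ¬other

  ∣p∣≤1 : ∣ p ∣ ℕ.≤ 1
  ∣p∣≤1 = subst (∣ p ∣ ℕ.≤_) (∣⁅x⁆∣≡1 x) (p⊆q⇒∣p∣≤∣q∣ p⊆⁅x⁆)

IsLeast : Subset n → Fin n → Set
IsLeast p x = x ∈ p × (∀ y → y ∈ p → x ≤ y)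

isLeast? : (p : Subset n) → Decidable (IsLeast p)
isLeast? p x = (x ∈? p) ×-dec all? (λ y → (y ∈? p) →-dec (x ≤? y))

IsLeast-unique : {p : Subset n} → IsLeast p x → IsLeast p y → x ≡ y
IsLeast-unique (x∈p , x≤) (y∈p , y≤) = ≤-antisym (x≤ _ y∈p) (y≤ _ x∈p)

Nonempty⇒∃-least : {p : Subset n} → Nonempty p → ∃ (IsLeast p)
Nonempty⇒∃-least {p = inside ∷ p} _ = zero , here , λ _ _ → z≤n
Nonempty⇒∃-least {p = outside ∷ p} (suc x , there x∈p) with Nonempty⇒∃-least (x , x∈p)
... | w , w∈p , w≤ = suc w , there w∈p , λ { (suc y) (there y∈p) → s≤s (w≤ y y∈p) }

∣p∣≢1⇒∃-nonLeast : {p : Subset n} → x ∈ p → ∣ p ∣ ≢ 1 → ∃ λ y → y ∈ p × ¬ IsLeast p y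
∣p∣≢1⇒∃-nonLeast x∈p ∣p∣≢1 with Nonempty⇒∃-least (_ , x∈p)
... | w , least-w with ∣p∣≢1⇒∃-other (proj₁ least-w) ∣p∣≢1
... | y , y∈p , y≢w = y , y∈p , λ least-y → y≢w (IsLeast-unique least-y least-w)

∈-tabulate⁺ : {f : Fin n → Bool} → f x ≡ true → x ∈ tabulate f
∈-tabulate⁺ {x = x} {f} fx = lookup⇒[]= x (tabulate f) (trans (lookup∘tabulate f x) fx)

∈-tabulate⁻ : {f : Fin n → Bool} → x ∈ tabulate f → f x ≡ true
∈-tabulate⁻ {x = x} {f} x∈ = trans (sym (lookup∘tabulate f x)) ([]=⇒lookup x∈)

∈-cls⁺ : (E : EqRel n) → rel E x y ≡ true → y ∈ cls E x
∈-cls⁺ E = ∈-tabulate⁺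

∈-cls⁻ : (E : EqRel n) → y ∈ cls E x → rel E x y ≡ true
∈-cls⁻ E = ∈-tabulate⁻

cls-cong : (E : EqRel n) → rel E x y ≡ true → cls E x ≡ cls E y
cls-cong {x = x} {y} E xy = ⊆-antisym
  (λ {z} z∈ → ∈-cls⁺ E (transE E y x z (symE E x y xy) (∈-cls⁻ E z∈)))
  (λ {z} z∈ → ∈-cls⁺ E (transE E x y z xy (∈-cls⁻ E z∈)))

cls-injective : (E : EqRel n) → cls E x ≡ cls E y → rel E x y ≡ true
cls-injective {y = y} E eq = ∈-cls⁻ E (subst (y ∈_) (sym eq) (∈-cls⁺ E (reflE E y)))

∈-u⁺ : (E : EqRel n) → rel E x y ≡ true → y ∈ X → x ∈ u E X
∈-u⁺ {y = y} E xy y∈X = ∈-tabulate⁺ (Equivalence.to T-≡ (any⁺ _ (lose (∈-allFin y)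
  (Equivalence.from T-∧ (Equivalence.from T-≡ xy , Equivalence.from T-≡ ([]=⇒lookup y∈X))))))

∈-u⁻ : (E : EqRel n) (X : Subset n) → x ∈ u E X → ∃ λ y → rel E x y ≡ true × y ∈ X
∈-u⁻ {n} E X x∈ with satisfied (any⁻ _ (allFin n) (Equivalence.from T-≡ (∈-tabulate⁻ x∈)))
... | y , xy∧y∈X with Equivalence.to T-∧ xy∧y∈X
... | xy , y∈X = y , Equivalence.to T-≡ xy , lookup⇒[]= y X (Equivalence.to T-≡ y∈X)

meet : EqRel n → EqRel n → Fin n → Fin n → Subset n
meet E₁ E₂ x z = cls E₂ x ∩ cls E₁ z

∈-meet⁺ : (E₁ E₂ : EqRel n) → rel E₂ x y ≡ true → rel E₁ z y ≡ true → y ∈ meet E₁ E₂ x z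
∈-meet⁺ E₁ E₂ xy zy = x∈p∩q⁺ (∈-cls⁺ E₂ xy , ∈-cls⁺ E₁ zy)

∈-meet⁻ : (E₁ E₂ : EqRel n) → y ∈ meet E₁ E₂ x z → rel E₂ x y ≡ true × rel E₁ z y ≡ true
∈-meet⁻ {x = x} {z = z} E₁ E₂ y∈ with x∈p∩q⁻ (cls E₂ x) (cls E₁ z) y∈
... | y∈₂ , y∈₁ = ∈-cls⁻ E₂ y∈₂ , ∈-cls⁻ E₁ y∈₁

meet-cong : (E₁ E₂ : EqRel n) → y ∈ meet E₁ E₂ x z → meet E₁ E₂ x y ≡ meet E₁ E₂ x z
meet-cong {y = y} {x} {z} E₁ E₂ y∈ =
  cong (cls E₂ x ∩_) (cls-cong E₁ (symE E₁ z y (proj₂ (∈-meet⁻ E₁ E₂ y∈))))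

-- An E₂-step followed by an E₁-step, so that u E₂ (u E₁ X) is the set of points related to X.
Composite : EqRel n → EqRel n → Fin n → Fin n → Set
Composite E₁ E₂ x y = ∃ λ z → rel E₂ x z ≡ true × rel E₁ z y ≡ true

SameComposite : EqRel n → EqRel n → EqRel n → EqRel n → Set
SameComposite F₁ F₂ E₁ E₂ = ∀ x y → Composite F₁ F₂ x y ⇔ Composite E₁ E₂ x y

∈-u∘u⁺ : (E₁ E₂ : EqRel n) → y ∈ X → Composite E₁ E₂ x y → x ∈ u E₂ (u E₁ X)
∈-u∘u⁺ E₁ E₂ y∈X (z , xz , zy) = ∈-u⁺ E₂ xz (∈-u⁺ E₁ zy y∈X)

∈-u∘u⁻ : (E₁ E₂ : EqRel n) (X : Subset n) →
         x ∈ u E₂ (u E₁ X) → ∃ λ y → y ∈ X × Composite E₁ E₂ x y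
∈-u∘u⁻ E₁ E₂ X x∈ with ∈-u⁻ E₂ (u E₁ X) x∈
... | z , xz , z∈ with ∈-u⁻ E₁ X z∈
... | y , zy , y∈X = y , y∈X , z , xz , zy

u∘u-mono : (F₁ F₂ E₁ E₂ : EqRel n) → (∀ x y → Composite F₁ F₂ x y → Composite E₁ E₂ x y) →
           u F₂ (u F₁ X) ⊆ u E₂ (u E₁ X)
u∘u-mono {X = X} F₁ F₂ E₁ E₂ F⊆E x∈ with ∈-u∘u⁻ F₁ F₂ X x∈
... | y , y∈X , xFy = ∈-u∘u⁺ E₁ E₂ y∈X (F⊆E _ y xFy)

u∘u⁅⁆-reflects : (F₁ F₂ E₁ E₂ : EqRel n) → u F₂ (u F₁ ⁅ y ⁆) ⊆ u E₂ (u E₁ ⁅ y ⁆) →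
                 Composite F₁ F₂ x y → Composite E₁ E₂ x y
u∘u⁅⁆-reflects {y = y} F₁ F₂ E₁ E₂ F⊆E xFy
  with ∈-u∘u⁻ E₁ E₂ ⁅ y ⁆ (F⊆E (∈-u∘u⁺ F₁ F₂ (x∈⁅x⁆ y) xFy))
... | y′ , y′∈⁅y⁆ , xEy′ = subst (Composite E₁ E₂ _) (x∈⁅y⁆⇒x≡y y y′∈⁅y⁆) xEy′

represents⇔sameComposite : {Φ : Subset n → Subset n} (E₁ E₂ : EqRel n) → Represents Φ E₁ E₂ →
                           (F₁ F₂ : EqRel n) → Represents Φ F₁ F₂ ⇔ SameComposite F₁ F₂ E₁ E₂
represents⇔sameComposite E₁ E₂ repE F₁ F₂ = mk⇔
  (λ repF x y → mk⇔
    (u∘u⁅⁆-reflects {y = y} F₁ F₂ E₁ E₂ (⊆-reflexive (trans (sym (repF ⁅ y ⁆)) (repE ⁅ y ⁆))))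
    (u∘u⁅⁆-reflects {y = y} E₁ E₂ F₁ F₂ (⊆-reflexive (trans (sym (repE ⁅ y ⁆)) (repF ⁅ y ⁆)))))
  (λ same X → trans (repE X) (⊆-antisym
    (u∘u-mono {X = X} E₁ E₂ F₁ F₂ (λ x y → Equivalence.from (same x y)))
    (u∘u-mono {X = X} F₁ F₂ E₁ E₂ (λ x y → Equivalence.to (same x y)))))

Composite-transpose : (E₁ E₂ : EqRel n) → Composite E₁ E₂ x y → Composite E₂ E₁ y x
Composite-transpose {x = x} {y} E₁ E₂ (z , xz , zy) = z , symE E₁ z y zy , symE E₂ x z xz

SameComposite-transpose : (F₁ F₂ E₁ E₂ : EqRel n) →
                          SameComposite F₁ F₂ E₁ E₂ → SameComposite F₂ F₁ E₂ E₁
SameComposite-transpose F₁ F₂ E₁ E₂ same x y = mk⇔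
  (Composite-transpose E₁ E₂ ∘ Equivalence.to (same y x) ∘ Composite-transpose F₂ F₁)
  (Composite-transpose F₁ F₂ ∘ Equivalence.from (same y x) ∘ Composite-transpose E₂ E₁)

row : EqRel n → EqRel n → Fin n → Subset n
row E₁ E₂ x = u E₁ (cls E₂ x)

∈-row⁺ : (E₁ E₂ : EqRel n) → Composite E₁ E₂ x y → y ∈ row E₁ E₂ x
∈-row⁺ {y = y} E₁ E₂ (z , xz , zy) = ∈-u⁺ E₁ (symE E₁ z y zy) (∈-cls⁺ E₂ xz)

∈-row⁻ : (E₁ E₂ : EqRel n) → y ∈ row E₁ E₂ x → Composite E₁ E₂ x y
∈-row⁻ {y = y} {x} E₁ E₂ y∈ with ∈-u⁻ E₁ (cls E₂ x) y∈
... | z , yz , z∈ = z , ∈-cls⁻ E₂ z∈ , symE E₁ y z yz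

row-cong : (E₁ E₂ : EqRel n) → rel E₂ x y ≡ true → row E₁ E₂ x ≡ row E₁ E₂ y
row-cong E₁ E₂ xy = cong (u E₁) (cls-cong E₂ xy)

SameComposite⇒row≡ : (F₁ F₂ E₁ E₂ : EqRel n) → SameComposite F₁ F₂ E₁ E₂ → row F₁ F₂ x ≡ row E₁ E₂ x
SameComposite⇒row≡ {x = x} F₁ F₂ E₁ E₂ same = ⊆-antisym
  (λ {y} y∈ → ∈-row⁺ E₁ E₂ (Equivalence.to (same x y) (∈-row⁻ F₁ F₂ y∈)))
  (λ {y} y∈ → ∈-row⁺ F₁ F₂ (Equivalence.from (same x y) (∈-row⁻ E₁ E₂ y∈)))

_⊆ᴿ_ : EqRel n → EqRel n → Set
F ⊆ᴿ E = ∀ x y → rel F x y ≡ true → rel E x y ≡ true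

⊆ᴿ-antisym : (F E : EqRel n) → F ⊆ᴿ E → E ⊆ᴿ F → SameRel F E
⊆ᴿ-antisym F E F⊆E E⊆F x y = ⇔→≡ (mk⇔ (F⊆E x y) (E⊆F x y))

UniquelyFactors : EqRel n → EqRel n → Set
UniquelyFactors E₁ E₂ = ∀ F₁ F₂ → SameComposite F₁ F₂ E₁ E₂ → SameRel F₁ E₁ × SameRel F₂ E₂

UniquelyFactors-transpose : (E₁ E₂ : EqRel n) → UniquelyFactors E₁ E₂ → UniquelyFactors E₂ E₁
UniquelyFactors-transpose E₁ E₂ unique F₁ F₂ same =
  swap (unique F₂ F₁ (SameComposite-transpose F₁ F₂ E₂ E₁ same))

Separating : EqRel n → EqRel n → Set
Separating E₁ E₂ = ∀ x y → cls E₂ x ≢ cls E₂ y → row E₁ E₂ x ≢ row E₁ E₂ y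

HasSingletonMeets : EqRel n → EqRel n → Set
HasSingletonMeets E₁ E₂ = ∀ x → ∃ λ z → ∣ meet E₁ E₂ x z ∣ ≡ 1

FactorConditions : EqRel n → EqRel n → Set
FactorConditions E₁ E₂ =
  Separating E₁ E₂ × Separating E₂ E₁ × HasSingletonMeets E₁ E₂ × HasSingletonMeets E₂ E₁

Separating⇒row-injective : (E₁ E₂ : EqRel n) → Separating E₁ E₂ →
                           row E₁ E₂ x ≡ row E₁ E₂ y → rel E₂ x y ≡ true
Separating⇒row-injective {x = x} {y} E₁ E₂ separating eq = cls-injective E₂
  (decidable-stable (cls E₂ x ≟ˢ cls E₂ y) λ cls≢ → separating x y cls≢ eq)

secondFactor⊆ : (F₁ F₂ E₁ E₂ : EqRel n) → Separating E₁ E₂ → SameComposite F₁ F₂ E₁ E₂ → F₂ ⊆ᴿ E₂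
secondFactor⊆ F₁ F₂ E₁ E₂ separating same x y xy =
  Separating⇒row-injective E₁ E₂ separating (begin
    row E₁ E₂ x  ≡⟨ SameComposite⇒row≡ F₁ F₂ E₁ E₂ same ⟨
    row F₁ F₂ x  ≡⟨ row-cong F₁ F₂ xy ⟩
    row F₁ F₂ y  ≡⟨ SameComposite⇒row≡ F₁ F₂ E₁ E₂ same ⟩
    row E₁ E₂ y  ∎)
  where open ≡-Reasoning

secondFactor⊇ : (F₁ F₂ E₁ E₂ : EqRel n) → HasSingletonMeets E₁ E₂ →
                F₁ ⊆ᴿ E₁ → F₂ ⊆ᴿ E₂ → SameComposite F₁ F₂ E₁ E₂ → E₂ ⊆ᴿ F₂
secondFactor⊇ F₁ F₂ E₁ E₂ meets F₁⊆E₁ F₂⊆E₂ same x y xy with meets x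
... | z , ∣meet∣≡1 with ∣p∣≡1⇒Nonempty ∣meet∣≡1
... | a , a∈meet = transE F₂ x a y (F₂-toA x (reflE E₂ x)) (symE F₂ y a (F₂-toA y xy))
  where
  F₂-toA : ∀ y → rel E₂ x y ≡ true → rel F₂ y a ≡ true
  F₂-toA y xy with Equivalence.from (same y a)
    (a , transE E₂ y x a (symE E₂ x y xy) (proj₁ (∈-meet⁻ E₁ E₂ a∈meet)) , reflE E₁ a)
  ... | w , yw , wa = subst (λ t → rel F₂ y t ≡ true) (∣p∣≡1⇒∈-unique ∣meet∣≡1 w∈meet a∈meet) yw
    where
    w∈meet : w ∈ meet E₁ E₂ x z
    w∈meet = ∈-meet⁺ E₁ E₂ (transE E₂ x y w xy (F₂⊆E₂ y w yw))
      (transE E₁ z a w (proj₂ (∈-meet⁻ E₁ E₂ a∈meet)) (symE E₁ w a (F₁⊆E₁ w a wa)))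

secondFactor-unique : (F₁ F₂ E₁ E₂ : EqRel n) → Separating E₁ E₂ → Separating E₂ E₁ →
                      HasSingletonMeets E₁ E₂ → SameComposite F₁ F₂ E₁ E₂ → SameRel F₂ E₂
secondFactor-unique F₁ F₂ E₁ E₂ separating₁₂ separating₂₁ meets same =
  ⊆ᴿ-antisym F₂ E₂ F₂⊆E₂ (secondFactor⊇ F₁ F₂ E₁ E₂ meets F₁⊆E₁ F₂⊆E₂ same)
  where
  F₂⊆E₂ : F₂ ⊆ᴿ E₂
  F₂⊆E₂ = secondFactor⊆ F₁ F₂ E₁ E₂ separating₁₂ same

  F₁⊆E₁ : F₁ ⊆ᴿ E₁
  F₁⊆E₁ = secondFactor⊆ F₂ F₁ E₂ E₁ separating₂₁ (SameComposite-transpose F₁ F₂ E₁ E₂ same)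

FactorConditions⇒UniquelyFactors : (E₁ E₂ : EqRel n) → FactorConditions E₁ E₂ → UniquelyFactors E₁ E₂
FactorConditions⇒UniquelyFactors E₁ E₂ (separating₁₂ , separating₂₁ , meets₁₂ , meets₂₁) F₁ F₂ same =
  secondFactor-unique F₂ F₁ E₂ E₁ separating₂₁ separating₁₂ meets₂₁
    (SameComposite-transpose F₁ F₂ E₁ E₂ same) ,
  secondFactor-unique F₁ F₂ E₁ E₂ separating₁₂ separating₂₁ meets₁₂ same

does≡true⇒ : {P : Set} (P? : Dec P) → does P? ≡ true → P
does≡true⇒ (yes p) _ = p

kernel : {A : Set} → DecidableEquality A → (Fin n → A) → EqRel n
kernel _≟_ f = record
  { rel    = λ x y → does (f x ≟ f y)
  ; reflE  = λ x → dec-true (f x ≟ f x) refl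
  ; symE   = λ x y xy → dec-true (f y ≟ f x) (sym (does≡true⇒ (f x ≟ f y) xy))
  ; transE = λ x y z xy yz → dec-true (f x ≟ f z)
                               (trans (does≡true⇒ (f x ≟ f y) xy) (does≡true⇒ (f y ≟ f z) yz))
  }

kernel⁺ : {A : Set} (_≟_ : DecidableEquality A) (f : Fin n → A) →
          f x ≡ f y → rel (kernel _≟_ f) x y ≡ true
kernel⁺ {x = x} {y} _≟_ f = dec-true (f x ≟ f y)

kernel⁻ : {A : Set} (_≟_ : DecidableEquality A) (f : Fin n → A) →
          rel (kernel _≟_ f) x y ≡ true → f x ≡ f y
kernel⁻ {x = x} {y} _≟_ f = does≡true⇒ (f x ≟ f y)

rowKernel : EqRel n → EqRel n → EqRel n
rowKernel E₁ E₂ = kernel _≟ˢ_ (row E₁ E₂)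

rowKernel-sameComposite : (E₁ E₂ : EqRel n) → SameComposite E₁ (rowKernel E₁ E₂) E₁ E₂
rowKernel-sameComposite E₁ E₂ x y = mk⇔
  (λ { (z , xz , zy) → ∈-row⁻ E₁ E₂ (subst (y ∈_) (sym (kernel⁻ _≟ˢ_ (row E₁ E₂) xz))
                                           (∈-row⁺ E₁ E₂ (z , reflE E₂ z , zy))) })
  (λ { (z , xz , zy) → z , kernel⁺ _≟ˢ_ (row E₁ E₂) (row-cong E₁ E₂ xz) , zy })

UniquelyFactors⇒Separating : (E₁ E₂ : EqRel n) → UniquelyFactors E₁ E₂ → Separating E₁ E₂
UniquelyFactors⇒Separating E₁ E₂ unique x y cls≢ rows≡ = cls≢ (cls-cong E₂ (begin
  rel E₂ x y                 ≡⟨ rowKernel≈E₂ x y ⟨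
  rel (rowKernel E₁ E₂) x y  ≡⟨ kernel⁺ _≟ˢ_ (row E₁ E₂) rows≡ ⟩
  true                       ∎))
  where
  open ≡-Reasoning
  rowKernel≈E₂ : SameRel (rowKernel E₁ E₂) E₂
  rowKernel≈E₂ = proj₂ (unique E₁ (rowKernel E₁ E₂) (rowKernel-sameComposite E₁ E₂))

-- Refining E₂ inside [x₀]₂ by a marking that every meet [x₀]₂ ∩ [z]₁ meets both marked
-- and unmarked keeps the composite, since a step into [x₀]₂ can be redirected to a
-- point of the same meet carrying the mark of its starting point.
record SplittingMarking (E₁ E₂ : EqRel n) (x₀ : Fin n) : Set₁ where
  field
    Marked   : Fin n → Set
    marked?  : Decidable Marked
    marked⇒∈ : ∀ {a} → Marked a → rel E₂ x₀ a ≡ true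
    hits     : rel E₂ x₀ z ≡ true → ∀ b → ∃ λ w → w ∈ meet E₁ E₂ x₀ z × does (marked? w) ≡ b

  label : Fin n → Subset n × Bool
  label a = cls E₂ a , does (marked? a)

  _≟ˡ_ : DecidableEquality (Subset n × Bool)
  _≟ˡ_ = Product.≡-dec _≟ˢ_ _≟ᵇ_

  split : EqRel n
  split = kernel _≟ˡ_ label

  split⁺ : rel E₂ x y ≡ true → does (marked? x) ≡ does (marked? y) → rel split x y ≡ true
  split⁺ xy same-mark = kernel⁺ _≟ˡ_ label (cong₂ _,_ (cls-cong E₂ xy) same-mark)

  split⁻ : rel split x y ≡ true → does (marked? x) ≡ does (marked? y)
  split⁻ xy = cong proj₂ (kernel⁻ _≟ˡ_ label xy)

  split⊆ : split ⊆ᴿ E₂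
  split⊆ x y xy = cls-injective E₂ (cong proj₁ (kernel⁻ _≟ˡ_ label xy))

  throughMeet : rel E₂ x z ≡ true → rel E₁ z y ≡ true → rel E₂ x₀ z ≡ true → Composite E₁ split x y
  throughMeet {x = x} {z} {y} xz zy x₀z with hits x₀z (does (marked? x))
  ... | w , w∈meet , same-mark with ∈-meet⁻ E₁ E₂ w∈meet
  ... | x₀w , zw = w , split⁺ xw (sym same-mark) , transE E₁ w z y (symE E₁ z w zw) zy
    where
    xw : rel E₂ x w ≡ true
    xw = transE E₂ x x₀ w (transE E₂ x z x₀ xz (symE E₂ x₀ z x₀z)) x₀w

  outsideMeet : rel E₂ x z ≡ true → rel E₁ z y ≡ true → rel E₂ x₀ z ≡ false → Composite E₁ split x y
  outsideMeet {x = x} {z} {y} xz zy x₀z≢ =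
    z , split⁺ xz (trans (unmarked x xz) (sym (unmarked z (reflE E₂ z)))) , zy
    where
    unmarked : ∀ a → rel E₂ a z ≡ true → does (marked? a) ≡ false
    unmarked a az = dec-false (marked? a) λ marked →
      contradiction (trans (sym (transE E₂ x₀ a z (marked⇒∈ marked) az)) x₀z≢) λ ()

  split-sameComposite : SameComposite E₁ split E₁ E₂
  split-sameComposite x y = mk⇔ (λ { (z , xz , zy) → z , split⊆ x z xz , zy }) refine
    where
    refine : Composite E₁ E₂ x y → Composite E₁ split x y
    refine (z , xz , zy) with rel E₂ x₀ z in x₀z
    ... | true  = throughMeet xz zy x₀z
    ... | false = outsideMeet xz zy x₀z

  split≢ : ¬ SameRel split E₂
  split≢ same with hits (reflE E₂ x₀) true | hits (reflE E₂ x₀) false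
  ... | w₁ , w₁∈meet , marked-w₁ | w₀ , w₀∈meet , unmarked-w₀ =
    contradiction (trans (sym marked-w₁) (trans (split⁻ (trans (same w₁ w₀) w₁w₀)) unmarked-w₀)) λ ()
    where
    w₁w₀ : rel E₂ w₁ w₀ ≡ true
    w₁w₀ = transE E₂ w₁ x₀ w₀ (symE E₂ x₀ w₁ (proj₁ (∈-meet⁻ E₁ E₂ w₁∈meet)))
                              (proj₁ (∈-meet⁻ E₁ E₂ w₀∈meet))

leastMarking : (E₁ E₂ : EqRel n) (x₀ : Fin n) →
               (∀ z → ∣ meet E₁ E₂ x₀ z ∣ ≢ 1) → SplittingMarking E₁ E₂ x₀
leastMarking E₁ E₂ x₀ noSingleton = record
  { Marked   = λ a → IsLeast (meet E₁ E₂ x₀ a) a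
  ; marked?  = λ a → isLeast? (meet E₁ E₂ x₀ a) a
  ; marked⇒∈ = λ least → proj₁ (∈-meet⁻ E₁ E₂ (proj₁ least))
  ; hits     = hits
  }
  where
  hits : rel E₂ x₀ z ≡ true → ∀ b → ∃ λ w → w ∈ meet E₁ E₂ x₀ z × does (isLeast? (meet E₁ E₂ x₀ w) w) ≡ b
  hits {z} x₀z true with Nonempty⇒∃-least (z , ∈-meet⁺ E₁ E₂ x₀z (reflE E₁ z))
  ... | w , least = w , proj₁ least ,
    dec-true (isLeast? _ w) (subst (λ p → IsLeast p w) (sym (meet-cong E₁ E₂ (proj₁ least))) least)
  hits {z} x₀z false with ∣p∣≢1⇒∃-nonLeast (∈-meet⁺ E₁ E₂ x₀z (reflE E₁ z)) (noSingleton z)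
  ... | w , w∈meet , ¬least = w , w∈meet ,
    dec-false (isLeast? _ w) (¬least ∘ subst (λ p → IsLeast p w) (meet-cong E₁ E₂ w∈meet))

UniquelyFactors⇒HasSingletonMeets : (E₁ E₂ : EqRel n) → UniquelyFactors E₁ E₂ → HasSingletonMeets E₁ E₂
UniquelyFactors⇒HasSingletonMeets E₁ E₂ unique x₀ with any? (λ z → ∣ meet E₁ E₂ x₀ z ∣ ℕ.≟ 1)
... | yes singleton = singleton
... | no ¬singleton = contradiction (proj₂ (unique E₁ split split-sameComposite)) split≢
  where open SplittingMarking (leastMarking E₁ E₂ x₀ λ z ∣meet∣≡1 → ¬singleton (z , ∣meet∣≡1))

UniquelyFactors⇔FactorConditions : (E₁ E₂ : EqRel n) → UniquelyFactors E₁ E₂ ⇔ FactorConditions E₁ E₂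
UniquelyFactors⇔FactorConditions E₁ E₂ = mk⇔
  (λ unique → let unique′ = UniquelyFactors-transpose E₁ E₂ unique in
    UniquelyFactors⇒Separating E₁ E₂ unique , UniquelyFactors⇒Separating E₂ E₁ unique′ ,
    UniquelyFactors⇒HasSingletonMeets E₁ E₂ unique , UniquelyFactors⇒HasSingletonMeets E₂ E₁ unique′)
  (FactorConditions⇒UniquelyFactors E₁ E₂)

uniqueRepresentation⇔UniquelyFactors : {Φ : Subset n → Subset n} (E₁ E₂ : EqRel n) → Represents Φ E₁ E₂ →
  (∀ F₁ F₂ → Represents Φ F₁ F₂ → SameRel F₁ E₁ × SameRel F₂ E₂) ⇔ UniquelyFactors E₁ E₂
uniqueRepresentation⇔UniquelyFactors E₁ E₂ represents = mk⇔
  (λ unique F₁ F₂ → unique F₁ F₂ ∘ Equivalence.from (represents⇔sameComposite E₁ E₂ represents F₁ F₂))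
  (λ unique F₁ F₂ → unique F₁ F₂ ∘ Equivalence.to (represents⇔sameComposite E₁ E₂ represents F₁ F₂))

mainTheorem15 : (m : ℕ) → (T : Subset (suc m) → Subset (suc m))
    → (E₁ E₂ : EqRel (suc m)) → Represents T E₁ E₂
    → ((∀ (F₁ F₂ : EqRel (suc m)) → Represents T F₁ F₂ → SameRel F₁ E₁ × SameRel F₂ E₂)
       ⇔ ((∀ x y → cls E₂ x ≢ cls E₂ y → u E₁ (cls E₂ x) ≢ u E₁ (cls E₂ y))
         × (∀ x y → cls E₁ x ≢ cls E₁ y → u E₂ (cls E₁ x) ≢ u E₂ (cls E₁ y))
         × (∀ x → ∃ λ z → ∣ cls E₂ x ∩ cls E₁ z ∣ ≡ 1)
         × (∀ x → ∃ λ z → ∣ cls E₁ x ∩ cls E₂ z ∣ ≡ 1)))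
mainTheorem15 m T E₁ E₂ represents =
  ⇔-trans (uniqueRepresentation⇔UniquelyFactors E₁ E₂ represents) (UniquelyFactors⇔FactorConditions E₁ E₂)
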